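{- There exists a magma $A$ on the domain $D=\{0,1,2,3\}$ that satisfies the least number heuristic (LNH) with respect to the row-by-row vectorization, but is not minimal with respect to the set of all transpositions (and hence is not a lex-leader); for instance, the magma with $3\ast 3=2$ and $x\ast y=0$ for all other $x,y\in D$.
   Context: A magma $A=(D,\ast)$ is a set $D$ with a binary operation; write $A(r,c)=r\ast c$. For a permutation $\pi$ of $D$, the isomorphic copy $\pi(A)$ is the magma on $D$ with $\pi(A)(a,b)=\pi\big(A(\pi^{ -1}(a),\pi^{ -1}(b))\big)$. The row-by-row vectorization enumerates cells as $(r_1,c_1),\dots,(r_{16},c_{16})$ = $(0,0),(0,1),\dots,(0,3),(1,0),\dots,(3,3)$ (rows top-down, each row left to right); the vector of $A$ is $(A(r_1,c_1),\dots,A(r_{16},c_{16}))$, and $A\preceq B$ means the vector of $A$ is lexicographically smaller than or equal to that of $B$. $A$ is minimal with respect to the set of all transpositions if $A\preceq\tau(A)$ for every transposition $\tau$ of $D$; $A$ is a lex-leader if $A\preceq B$ for every magma $B$ isomorphic to $A$. $A$ satisfies LNH if for every $i$, $A(r_i,c_i)\le 1+\max\big(\{r_j,c_j: j\le i\}\cup\{A(r_j,c_j): j<i\}\big)$. -}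

module Defs where

open import Data.Nat using (ℕ; zero; suc; _≤_; _<_; _⊔_)
open import Data.Fin using (Fin; toℕ)
open import Data.Fin.Patterns using (0F; 1F; 2F; 3F)
open import Data.Fin.Permutation using (Permutation′; _⟨$⟩ʳ_; _⟨$⟩ˡ_; transpose)
open import Data.List using (List; []; _∷_; map; concatMap; allFin; foldr; upTo)
open import Data.Product using (_×_; _,_; proj₁; proj₂)
open import Relation.Binary.PropositionalEquality using (_≡_; _≢_)
open import Data.Unit using (⊤)

D : Set
D = Fin 4

Magma : Set
Magma = D → D → D

permMagma : Permutation′ 4 → Magma → Magma
permMagma π A a b = π ⟨$⟩ʳ A (π ⟨$⟩ˡ a) (π ⟨$⟩ˡ b)

cells : List (D × D)
cells = concatMap (λ r → map (λ c → (r , c)) (allFin 4)) (allFin 4)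

vec : Magma → List ℕ
vec A = map (λ rc → toℕ (A (proj₁ rc) (proj₂ rc))) cells

-- lexicographic ≤ on lists of naturals (used on equal-length lists)
data _≤lex_ : List ℕ → List ℕ → Set where
  []≤    : ∀ {ys} → [] ≤lex ys
  here<  : ∀ {x y xs ys} → x < y → (x ∷ xs) ≤lex (y ∷ ys)
  there≡ : ∀ {x xs ys} → xs ≤lex ys → (x ∷ xs) ≤lex (x ∷ ys)

_⪯_ : Magma → Magma → Set
A ⪯ B = vec A ≤lex vec B

MinimalWrtTranspositions : Magma → Set
MinimalWrtTranspositions A = ∀ (i j : D) → i ≢ j → A ⪯ permMagma (transpose i j) A

LexLeader : Magma → Set
LexLeader A = ∀ (π : Permutation′ 4) → A ⪯ permMagma π A

-- LNH: for every i (1-based position in the row-by-row order),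
-- A(r_i,c_i) ≤ 1 + max({r_j,c_j : j ≤ i} ∪ {A(r_j,c_j) : j < i}).
-- We traverse the cells keeping m = max of all coordinates and values of earlier cells
-- (m starts at 0, harmless since the set always contains r_i, c_i ≥ 0).
LNHFrom : Magma → ℕ → List (D × D) → Set
LNHFrom A m [] = ⊤
LNHFrom A m ((r , c) ∷ rest) =
  let m' = m ⊔ toℕ r ⊔ toℕ c
      v  = toℕ (A r c)
  in (v ≤ suc m') × LNHFrom A (m' ⊔ v) rest

LNH : Magma → Set
LNH A = LNHFrom A 0 cells

exampleMagma : Magma
exampleMagma 3F 3F = 2F
exampleMagma _  _  = 0F

{-# OPTIONS --safe #-}
module Submission where

open import Defs
open import Data.Fin using (toℕ)
open import Data.Fin.Patterns using (1F; 2F)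
open import Data.Fin.Permutation using (transpose)
open import Data.List using (List; []; _∷_)
open import Data.Nat using (ℕ; suc; _⊔_)
open import Data.Nat.Properties using (<-cmp; _≤?_)
open import Data.Product using (Σ; _×_; _,_)
open import Data.Unit using (tt)
open import Relation.Binary.Definitions using (Decidable; tri<; tri≈; tri>)
open import Relation.Binary.PropositionalEquality using (refl)
open import Relation.Nullary using (¬_; Dec; yes; no; contradiction)
open import Relation.Nullary.Decidable using (_×-dec_; map′; from-yes; from-no)

_≤lex?_ : Decidable {A = List ℕ} _≤lex_
[]       ≤lex? ys       = yes []≤
(x ∷ xs) ≤lex? []       = no λ ()
(x ∷ xs) ≤lex? (y ∷ ys) with <-cmp x y
... | tri< x<y _   _   = yes (here< x<y)
... | tri≈ x≮x refl _ = map′ there≡ tail-≤lex (xs ≤lex? ys)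
  where
  tail-≤lex : (x ∷ xs) ≤lex (x ∷ ys) → xs ≤lex ys
  tail-≤lex (here< x<x) = contradiction x<x x≮x
  tail-≤lex (there≡ le) = le
... | tri> x≮y x≢y _   = no λ { (here< x<y) → x≮y x<y ; (there≡ _) → x≢y refl }

_⪯?_ : Decidable _⪯_
A ⪯? B = vec A ≤lex? vec B

lnhFrom? : ∀ A m cs → Dec (LNHFrom A m cs)
lnhFrom? A m []              = yes tt
lnhFrom? A m ((r , c) ∷ rest) =
  let m′ = m ⊔ toℕ r ⊔ toℕ c
      v  = toℕ (A r c)
  in (v ≤? suc m′) ×-dec lnhFrom? A (m′ ⊔ v) rest

lnh? : ∀ A → Dec (LNH A)
lnh? A = lnhFrom? A 0 cells

LexLeader⇒MinimalWrtTranspositions : ∀ {A} → LexLeader A → MinimalWrtTranspositions A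
LexLeader⇒MinimalWrtTranspositions leader i j _ = leader (transpose i j)

exampleMagma-LNH : LNH exampleMagma
exampleMagma-LNH = from-yes (lnh? exampleMagma)

-- Swapping 1 and 2 fixes every product 0 and turns 3 ∗ 3 = 2 into 1, so the copy is
-- lexicographically smaller, differing only in the last cell.
exampleMagma-¬minimal : ¬ MinimalWrtTranspositions exampleMagma
exampleMagma-¬minimal minimal =
  from-no (exampleMagma ⪯? permMagma (transpose 1F 2F) exampleMagma) (minimal 1F 2F λ ())

exampleMagma-¬lexLeader : ¬ LexLeader exampleMagma
exampleMagma-¬lexLeader leader =
  exampleMagma-¬minimal (LexLeader⇒MinimalWrtTranspositions {exampleMagma} leader)

mainTheorem2 : Σ Magma (λ A → LNH A × ¬ MinimalWrtTranspositions A × ¬ LexLeader A)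
                 × (LNH exampleMagma × ¬ MinimalWrtTranspositions exampleMagma × ¬ LexLeader exampleMagma)
mainTheorem2 = (exampleMagma , properties) , properties
  where
  properties : LNH exampleMagma × ¬ MinimalWrtTranspositions exampleMagma × ¬ LexLeader exampleMagma
  properties = exampleMagma-LNH , exampleMagma-¬minimal , exampleMagma-¬lexLeader
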